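{- Let $\mathcal{D}=\{(\Sigma_k,L_k,G_k)\}_{k\in\mathbb{N}}$ be a treelike decomposition class with automation $\mathcal{A}=\{A_k\}_k$, and let $C$ be a $\mathcal{D}$-coherent treelike DP-core. For each $k\in\mathbb{N}$, $P(\mathcal{D}_k)\not\subseteq P(C,\mathcal{D})$ if and only if some $(\mathcal{A},C,k)$-refutation exists.
   Context: Graphs: triples $G=(V,E,I)$, $V,E$ finite subsets of $\mathbb{N}$, $I\subseteq E\times V$; $\simeq$ isomorphism; isomorphism closure of a set of graphs = all graphs isomorphic to one of its members. Terms over a ranked alphabet: finite rooted ordered labelled trees (arity = number of children). A tree automaton has states, final states and transitions $a(q_1,\dots,q_p)\to q$ for symbols $a$ of arity $p$ ($a\to q$ for arity $0$). Treelike decomposition class: $\mathcal{D}=\{(\Sigma_k,L_k,G_k)\}_{k}$, $\Sigma_k$ ranked alphabet, $L_k$ regular tree language over $\Sigma_k$, $G_k:L_k\to$ graphs, $\Sigma_k\subseteq\Sigma_{k+1}$, $L_k\subseteq L_{k+1}$, $G_{k+1}|_{L_k}=G_k$; $G(\tau)=G_k(\tau)$; $P(\mathcal{D}_k)$ = isomorphism closure of $\{G(\tau):\tau\in L_k\}$. An automation is a sequence of tree automata $A_k$ over $\Sigma_k$ accepting exactly $L_k$. Treelike DP-core $C=\{C[k]\}$, $C[k]=(\Sigma_k,W_k,F_k,T_k,\mathrm{Clean}_k,\mathrm{Inv}_k)$: $W_k\subseteq\{0,1\}^*$ decidable; $F_k:W_k\to\{0,1\}$ ($w$ final iff $F_k(w)=1$);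 a finite $\hat a\subseteq W_k$ for each arity-$0$ $a$; $\hat a:W_k^p\to$ finite subsets of $W_k$ for arity $p\ge1$; $\mathrm{Clean}_k$ finite subsets $\to$ finite subsets; $\mathrm{Inv}_k$ finite subsets $\to\{0,1\}^*$. $\hat a(S_1,\dots,S_p)=\mathrm{Clean}_k(\bigcup_{w_i\in S_i}\hat a(w_1,\dots,w_p))$. $\mathrm{Dyn}_k(a)=\hat a$ (arity 0), $\mathrm{Dyn}_k(a(\tau_1,\dots,\tau_p))=\hat a(\mathrm{Dyn}_k(\tau_1),\dots,\mathrm{Dyn}_k(\tau_p))$; $\tau$ accepted by $C[k]$ iff $\mathrm{Dyn}_k(\tau)$ has a final witness. $P(C,\mathcal{D})$ = isomorphism closure of $\{G(\tau):\tau\in L_k$ accepted by $C[k]$, some $k\}$. $\mathcal{D}$-coherent: alphabets of $C$ are the $\Sigma_k$, and for $\tau\in L_k,\tau'\in L_{k'}$ with $G(\tau)\simeq G(\tau')$: acceptance by $C[k]$ and $C[k']$ agree, and $\mathrm{Inv}_k(\mathrm{Dyn}_k(\tau))=\mathrm{Inv}_{k'}(\mathrm{Dyn}_{k'}(\tau'))$. Refutations: an $(\mathcal{A},C,k)$-pair is $(q,S)$ with $q$ a state of $A_k$ and $S\subseteq W_k$; it is inconsistent if $q$ is final in $A_k$ but $S$ has no final witness. An $(\mathcal{A},C,k)$-refutation is a sequence of pairs $(q_1,S_1)\dots(q_m,S_m)$ such that $(q_m,S_m)$ is inconsistent and for each $i\in[m]$ either $(q_i,S_i)=(q,\hat a)$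 for an arity-$0$ symbol $a\in\Sigma_k$ with $a\to q$ a transition of $A_k$, or $(q_i,S_i)=(q,\hat a(S_{j_1},\dots,S_{j_p}))$ for some $j_1,\dots,j_p<i$, a symbol $a\in\Sigma_k$ of arity $p>0$ and a transition $a(q_{j_1},\dots,q_{j_p})\to q$ of $A_k$. -}

module Defs where

open import Data.Nat using (ℕ; zero; suc)
open import Data.Bool using (Bool; true; false; T)
open import Data.List using (List; []; _∷_; concatMap) renaming (map to lmap)
open import Data.List.Membership.Propositional using (_∈_)
open import Data.List.Relation.Unary.All using (All)
open import Data.Vec using (Vec; []; _∷_) renaming (map to vmap)
open import Data.Vec.Relation.Unary.All using () renaming (All to VAll)
open import Data.Vec.Relation.Binary.Pointwise.Inductive using (Pointwise)
open import Data.Fin using (Fin; _<_; fromℕ)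
open import Data.Product using (Σ; ∃; _×_; _,_; proj₁; proj₂)
open import Relation.Nullary using (¬_)
open import Relation.Binary.PropositionalEquality using (_≡_)
open import Function using (_∘_)
open import Function.Bundles using (_⇔_)

-- Finite sets represented by lists; extensional equality of such sets

_≈ˢ_ : {A : Set} → List A → List A → Set
S ≈ˢ S' = ∀ x → (x ∈ S → x ∈ S') × (x ∈ S' → x ∈ S)

record Graph : Set where
  field
    V : List ℕ
    E : List ℕ
    I : List (ℕ × ℕ)
    I⊆E×V : All (λ p → (proj₁ p ∈ E) × (proj₂ p ∈ V)) I
open Graph public

_≐_ : Graph → Graph → Set
G ≐ H = (V G ≈ˢ V H) × (E G ≈ˢ E H) × (I G ≈ˢ I H)

record _≃_ (G H : Graph) : Set where
  field
    fV gV fE gE : ℕ → ℕ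
    fV∈ : ∀ {v} → v ∈ V G → fV v ∈ V H
    gV∈ : ∀ {v} → v ∈ V H → gV v ∈ V G
    gfV : ∀ {v} → v ∈ V G → gV (fV v) ≡ v
    fgV : ∀ {v} → v ∈ V H → fV (gV v) ≡ v
    fE∈ : ∀ {e} → e ∈ E G → fE e ∈ E H
    gE∈ : ∀ {e} → e ∈ E H → gE e ∈ E G
    gfE : ∀ {e} → e ∈ E G → gE (fE e) ≡ e
    fgE : ∀ {e} → e ∈ E H → fE (gE e) ≡ e
    I-pres : ∀ {e v} → e ∈ E G → v ∈ V G →
             ((e , v) ∈ I G) ⇔ ((fE e , fV v) ∈ I H)

module Terms (Sym : Set) (ar : Sym → ℕ) where

  data Term : Set where
    node : (a : Sym) → Vec Term (ar a) → Term

  data Over (Σ' : List Sym) : Term → Set where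
    node : ∀ {a ts} → a ∈ Σ' → VAll (Over Σ') ts → Over Σ' (node a ts)

  record TreeAutomaton (Σ' : List Sym) : Set where
    field
      nQ    : ℕ
      final : Fin nQ → Bool
      δ     : (a : Sym) → Vec (Fin nQ) (ar a) → Fin nQ → Bool
      δ-over : ∀ a qs q → T (δ a qs q) → a ∈ Σ'

  module _ {Σ' : List Sym} (A : TreeAutomaton Σ') where
    open TreeAutomaton A

    data Run : Term → Fin nQ → Set where
      run : ∀ {a ts q} (qs : Vec (Fin nQ) (ar a)) → T (δ a qs q) →
            Pointwise Run ts qs → Run (node a ts) q

    Accepts : Term → Set
    Accepts τ = ∃ λ q → T (final q) × Run τ q

  record DecompositionClass : Set₁ where
    field
      Alph     : ℕ → List Sym
      Alph-mono : ∀ k {a} → a ∈ Alph k → a ∈ Alph (suc k)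
      L        : ℕ → Term → Set
      L-over   : ∀ k τ → L k τ → Over (Alph k) τ
      L-mono   : ∀ k τ → L k τ → L (suc k) τ
      G        : ℕ → Term → Graph                 -- G_k (only relevant on L_k)
      G-compat : ∀ k τ → L k τ → G (suc k) τ ≐ G k τ

  -- automation: A_k over Σ_k accepting exactly L_k (this also witnesses regularity)
  record Automation (D : DecompositionClass) : Set where
    open DecompositionClass D
    field
      A     : (k : ℕ) → TreeAutomaton (Alph k)
      exact : ∀ k τ → L k τ ⇔ Accepts (A k) τ

  Bits : Set
  Bits = List Bool

  Wit : (ℕ → Bits → Bool) → ℕ → Set
  Wit W k = Σ Bits (λ w → T (W k w))

  record DPCore : Set₁ where
    field
      W     : ℕ → Bits → Bool
      F     : ∀ k → Wit W k → Bool
      hat   : ∀ k (a : Sym) → Vec (Wit W k) (ar a) → List (Wit W k)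
                                                            -- arity 0: the finite set â
      Clean : ∀ k → List (Wit W k) → List (Wit W k)
      Inv   : ∀ k → List (Wit W k) → Bits
      -- Clean_k and Inv_k are functions of finite *sets*
      Clean-ext : ∀ k S S' → S ≈ˢ S' → Clean k S ≈ˢ Clean k S'
      Inv-ext   : ∀ k S S' → S ≈ˢ S' → Inv k S ≡ Inv k S'

  choices : {A : Set} {n : ℕ} → Vec (List A) n → List (Vec A n)
  choices [] = [] ∷ []
  choices (S ∷ Ss) = concatMap (λ w → lmap (w ∷_) (choices Ss)) S

  module Core (C : DPCore) where
    open DPCore C

    liftSet : ∀ k (n : ℕ) → (Vec (Wit W k) n → List (Wit W k)) →
              Vec (List (Wit W k)) n → List (Wit W k)
    liftSet k zero    f []  = f []
    liftSet k (suc n) f Ss  = Clean k (concatMap f (choices Ss))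

    hatSet : ∀ k (a : Sym) → Vec (List (Wit W k)) (ar a) → List (Wit W k)
    hatSet k a = liftSet k (ar a) (hat k a)

    mutual
      Dyn : ∀ k → Term → List (Wit W k)
      Dyn k (node a ts) = hatSet k a (DynVec k ts)

      DynVec : ∀ k {n} → Vec Term n → Vec (List (Wit W k)) n
      DynVec k [] = []
      DynVec k (t ∷ ts) = Dyn k t ∷ DynVec k ts

    HasFinal : ∀ k → List (Wit W k) → Set
    HasFinal k S = ∃ λ w → w ∈ S × T (F k w)

    AcceptedBy : ℕ → Term → Set
    AcceptedBy k τ = HasFinal k (Dyn k τ)

  module Setting (D : DecompositionClass) (C : DPCore) where
    open DecompositionClass D
    open DPCore C
    open Core C

    Coherent : Set
    Coherent = ∀ k k' τ τ' → L k τ → L k' τ' → G k τ ≃ G k' τ' →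
               (AcceptedBy k τ ⇔ AcceptedBy k' τ') ×
               (Inv k (Dyn k τ) ≡ Inv k' (Dyn k' τ'))

    InPD : ℕ → Graph → Set
    InPD k H = ∃ λ τ → L k τ × (H ≃ G k τ)

    InPC : Graph → Set
    InPC H = ∃ λ k → ∃ λ τ → L k τ × AcceptedBy k τ × (H ≃ G k τ)

    NotSubset : ℕ → Set
    NotSubset k = ∃ λ H → InPD k H × ¬ InPC H

    module Refute (𝒜 : Automation D) where
      open Automation 𝒜
      open TreeAutomaton

      PairT : ℕ → Set
      PairT k = Fin (nQ (A k)) × List (Wit W k)

      Inconsistent : ∀ k → PairT k → Set
      Inconsistent k (q , S) = T (final (A k) q) × ¬ HasFinal k S

      Justified : ∀ k {m} → (Fin m → PairT k) → Fin m → Set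
      Justified k {m} seq i =
        ∃ λ a → a ∈ Alph k × Σ (Vec (Fin m) (ar a)) λ js →
          VAll (λ j → j < i) js ×
          T (δ (A k) a (vmap (proj₁ ∘ seq) js) (proj₁ (seq i))) ×
          (proj₂ (seq i) ≡ hatSet k a (vmap (proj₂ ∘ seq) js))

      Refutation : ℕ → Set
      Refutation k = ∃ λ m → Σ (Fin (suc m) → PairT k) λ seq →
        Inconsistent k (seq (fromℕ m)) × (∀ i → Justified k seq i)

-- A pair (q, S) is realized if S = Dyn_k(τ) for a term τ on which A_k has a
-- run ending in q.  Reading a refutation front to back builds such terms
-- bottom-up, and listing the subterms of a run in post-order gives a
-- refutation back; so refutations exist iff some realized pair is
-- inconsistent, i.e. iff some τ ∈ L_k is rejected by C[k].  Such a τ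
-- witnesses G(τ) ∈ P(D_k) ∖ P(C, D), because coherence makes acceptance by C
-- invariant under isomorphism of the represented graphs.
module Submission where

open import Defs
open import Level using (0ℓ)
open import Data.Bool using (T)
open import Data.Nat as ℕ using (ℕ; zero; suc)
open import Data.Vec using (Vec; []; _∷_) renaming (map to vmap)
open import Data.Vec.Properties using (map-∘; map-cong)
open import Data.Vec.Relation.Unary.All as VAll using ([]; _∷_) renaming (All to VAll)
open import Data.Vec.Relation.Unary.All.Properties using (map⁺)
open import Data.Vec.Relation.Binary.Pointwise.Inductive using (Pointwise; []; _∷_)
open import Data.Fin using (Fin; zero; suc; fromℕ; inject₁; toℕ; _<_)
open import Data.Fin.Properties using (toℕ-inject₁; toℕ-fromℕ; inject₁ℕ<)
open import Data.Fin.Induction using (<-wellFounded)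
open import Data.Fin.Relation.Unary.Top using (view; ‵fromℕ; ‵inject₁)
open import Data.Product using (Σ; ∃; _×_; _,_; proj₁; proj₂)
open import Induction.WellFounded as WF using ()
open import Relation.Nullary using (¬_)
open import Relation.Binary.PropositionalEquality
open import Function using (_∘_; id)
open import Function.Bundles using (_⇔_; mk⇔; Equivalence)
open import Function.Properties.Equivalence using () renaming (trans to ⇔-trans; sym to ⇔-sym)

≃-refl : ∀ H → H ≃ H
≃-refl H = record
  { fV = id ; gV = id ; fE = id ; gE = id
  ; fV∈ = id ; gV∈ = id ; gfV = λ _ → refl ; fgV = λ _ → refl
  ; fE∈ = id ; gE∈ = id ; gfE = λ _ → refl ; fgE = λ _ → refl
  ; I-pres = λ _ _ → mk⇔ id id
  }

inject₁-mono : ∀ {n} {i j : Fin n} → i < j → inject₁ i < inject₁ j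
inject₁-mono {i = i} {j} = subst₂ ℕ._<_ (sym (toℕ-inject₁ i)) (sym (toℕ-inject₁ j))

inject₁<fromℕ : ∀ {n} (i : Fin n) → inject₁ i < fromℕ n
inject₁<fromℕ {n} i = subst (toℕ (inject₁ i) ℕ.<_) (sym (toℕ-fromℕ n)) (inject₁ℕ< i)

module _ {A : Set} where

  snoc : ∀ {n} → (Fin n → A) → A → Fin (suc n) → A
  snoc {zero}  s x zero    = x
  snoc {suc n} s x zero    = s zero
  snoc {suc n} s x (suc i) = snoc (s ∘ suc) x i

  snoc-inject₁ : ∀ {n} (s : Fin n → A) x i → snoc s x (inject₁ i) ≡ s i
  snoc-inject₁ {suc n} s x zero    = refl
  snoc-inject₁ {suc n} s x (suc i) = snoc-inject₁ (s ∘ suc) x i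

  snoc-fromℕ : ∀ {n} (s : Fin n → A) x → snoc s x (fromℕ n) ≡ x
  snoc-fromℕ {zero}  s x = refl
  snoc-fromℕ {suc n} s x = snoc-fromℕ (s ∘ suc) x

  record _↪_ {m n} (s : Fin m → A) (t : Fin n → A) : Set where
    field
      ι        : Fin m → Fin n
      ι-lookup : ∀ i → t (ι i) ≡ s i
      ι-mono   : ∀ {i j} → i < j → ι i < ι j

  open _↪_ public

  ↪-refl : ∀ {n} {s : Fin n → A} → s ↪ s
  ↪-refl = record { ι = id ; ι-lookup = λ _ → refl ; ι-mono = id }

  ↪-trans : ∀ {l m n} {s : Fin l → A} {t : Fin m → A} {u : Fin n → A} →
            s ↪ t → t ↪ u → s ↪ u
  ↪-trans e f = record
    { ι        = ι f ∘ ι e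
    ; ι-lookup = λ i → trans (ι-lookup f (ι e i)) (ι-lookup e i)
    ; ι-mono   = ι-mono f ∘ ι-mono e
    }

  ↪-snoc : ∀ {n} (s : Fin n → A) x → s ↪ snoc s x
  ↪-snoc s x = record { ι = inject₁ ; ι-lookup = snoc-inject₁ s x ; ι-mono = inject₁-mono }

  map-↪ : ∀ {B : Set} {m n p} {s : Fin m → A} {t : Fin n → A} (e : s ↪ t) (f : A → B)
          (js : Vec (Fin m) p) → vmap (f ∘ t) (vmap (ι e) js) ≡ vmap (f ∘ s) js
  map-↪ e f js = trans (sym (map-∘ _ (ι e) js)) (map-cong (cong f ∘ ι-lookup e) js)

module Refutations (Sym : Set) (ar : Sym → ℕ) (D : Terms.DecompositionClass Sym ar)
                   (𝒜 : Terms.Automation Sym ar D) (C : Terms.DPCore Sym ar) (k : ℕ) where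
  open Terms Sym ar
  open DecompositionClass D
  open Automation 𝒜
  open TreeAutomaton (A k)
  open DPCore C
  open Core C
  open Setting D C
  open Refute 𝒜

  Pair : Set
  Pair = PairT k

  Realized : Pair → Set
  Realized (q , S) = ∃ λ τ → Run (A k) τ q × Dyn k τ ≡ S

  AllJustified : ∀ {n} → (Fin n → Pair) → Set
  AllJustified s = ∀ i → Justified k s i

  Justified-↪ : ∀ {m n} {s : Fin m → Pair} {t : Fin n → Pair} (e : s ↪ t) i →
                Justified k s i → Justified k t (ι e i)
  Justified-↪ {s = s} {t} e i (a , a∈ , js , js<i , tr , Sᵢ≡) =
    a , a∈ , vmap (ι e) js , map⁺ (VAll.map (ι-mono e) js<i) ,
    subst₂ (λ qs q → T (δ a qs q)) (sym (map-↪ e proj₁ js)) (sym (cong proj₁ (ι-lookup e i))) tr ,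
    trans (cong proj₂ (ι-lookup e i)) (trans Sᵢ≡ (cong (hatSet k a) (sym (map-↪ e proj₂ js))))

  snoc-justified : ∀ {n} (s : Fin n → Pair) x → AllJustified s →
                   Justified k (snoc s x) (fromℕ n) → AllJustified (snoc s x)
  snoc-justified s x ok ok-x i with view i
  ... | ‵fromℕ     = ok-x
  ... | ‵inject₁ j = Justified-↪ (↪-snoc s x) j (ok j)

  realize-all : ∀ {n p} {s : Fin n → Pair} (js : Vec (Fin n) p) → VAll (Realized ∘ s) js →
                Σ (Vec Term p) λ ts → Pointwise (Run (A k)) ts (vmap (proj₁ ∘ s) js) ×
                                      DynVec k ts ≡ vmap (proj₂ ∘ s) js
  realize-all [] [] = [] , [] , refl
  realize-all (j ∷ js) ((t , r , t≡) ∷ rs) with realize-all js rs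
  ... | ts , rs′ , ts≡ = t ∷ ts , r ∷ rs′ , cong₂ _∷_ t≡ ts≡

  justified⇒realized : ∀ {n} {s : Fin n → Pair} → AllJustified s → ∀ i → Realized (s i)
  justified⇒realized {s = s} ok = WF.All.wfRec <-wellFounded 0ℓ (Realized ∘ s) step
    where
    step : ∀ i → (∀ {j} → j < i → Realized (s j)) → Realized (s i)
    step i ih with ok i
    ... | a , _ , js , js<i , tr , Sᵢ≡ with realize-all js (VAll.map ih js<i)
    ... | ts , rs , ts≡ = node a ts , run _ tr rs , trans (cong (hatSet k a) ts≡) (sym Sᵢ≡)

  record Derivation : Set where
    constructor derivation
    field
      {length} : ℕ
      pairs     : Fin length → Pair
      justified : AllJustified pairs

  open Derivation

  empty : Derivation
  empty = derivation {0} (λ ()) (λ ())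

  record Extension (d : Derivation) (x : Pair) : Set where
    field
      m          : ℕ
      pairs′     : Fin (suc m) → Pair
      justified′ : AllJustified pairs′
      extends    : pairs d ↪ pairs′
      ends-in    : pairs′ (fromℕ m) ≡ x

  record ExtensionAll (d : Derivation) {p} (qs : Vec (Fin nQ) p) (ts : Vec Term p) : Set where
    field
      d′      : Derivation
      extends : pairs d ↪ pairs d′
      js      : Vec (Fin (length d′)) p
      states  : vmap (proj₁ ∘ pairs d′) js ≡ qs
      values  : vmap (proj₂ ∘ pairs d′) js ≡ DynVec k ts

  extend    : ∀ d {τ q} → Run (A k) τ q → Extension d (q , Dyn k τ)
  extendAll : ∀ d {p} {ts : Vec Term p} {qs} → Pointwise (Run (A k)) ts qs → ExtensionAll d qs ts

  extendAll d [] = record { d′ = d ; extends = ↪-refl ; js = [] ; states = refl ; values = refl }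
  extendAll d (r ∷ rs) with extend d r
  ... | record { m = m ; pairs′ = s ; justified′ = ok ; extends = e ; ends-in = last }
    with extendAll (derivation s ok) rs
  ... | record { d′ = d′ ; extends = e′ ; js = js ; states = qs≡ ; values = ts≡ } = record
    { d′ = d′ ; extends = ↪-trans e e′ ; js = ι e′ (fromℕ m) ∷ js
    ; states = cong₂ _∷_ (cong proj₁ root≡) qs≡
    ; values = cong₂ _∷_ (cong proj₂ root≡) ts≡ }
    where root≡ = trans (ι-lookup e′ (fromℕ m)) last

  extend d {node a ts} {q} (run qs tr rs) with extendAll d rs
  ... | record { d′ = derivation {n} s ok ; extends = e ; js = js ; states = qs≡ ; values = ts≡ } =
    record { m = n ; pairs′ = snoc s x ; justified′ = snoc-justified s x ok justified-x
           ; extends = ↪-trans e (↪-snoc s x) ; ends-in = snoc-fromℕ s x }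
    where
    x : Pair
    x = q , hatSet k a (DynVec k ts)
    justified-x : Justified k (snoc s x) (fromℕ n)
    justified-x =
      a , δ-over a qs q tr , vmap inject₁ js , map⁺ (VAll.universal inject₁<fromℕ js) ,
      subst₂ (λ qs′ q′ → T (δ a qs′ q′))
        (sym (trans (map-↪ (↪-snoc s x) proj₁ js) qs≡)) (sym (cong proj₁ (snoc-fromℕ s x))) tr ,
      trans (cong proj₂ (snoc-fromℕ s x))
        (cong (hatSet k a) (sym (trans (map-↪ (↪-snoc s x) proj₂ js) ts≡)))

  Refutation⇔inconsistent-realized : Refutation k ⇔ ∃ λ x → Realized x × Inconsistent k x
  Refutation⇔inconsistent-realized = mk⇔
    (λ (m , s , incons , ok) → s (fromℕ m) , justified⇒realized ok (fromℕ m) , incons)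
    λ { ((q , S) , (τ , r , refl) , incons) →
          let open Extension (extend empty r)
          in m , pairs′ , subst (Inconsistent k) (sym ends-in) incons , justified′ }

  Rejected : Term → Set
  Rejected τ = L k τ × ¬ AcceptedBy k τ

  rejected⇔inconsistent-realized : (∃ Rejected) ⇔ (∃ λ x → Realized x × Inconsistent k x)
  rejected⇔inconsistent-realized = mk⇔
    (λ (τ , τ∈L , rejected) → let (q , q-final , r) = Equivalence.to (exact k τ) τ∈L
                              in (q , Dyn k τ) , (τ , r , refl) , q-final , rejected)
    λ { ((q , _) , (τ , r , refl) , q-final , rejected) →
          τ , Equivalence.from (exact k τ) (q , q-final , r) , rejected }

  NotSubset⇔rejected : Coherent → NotSubset k ⇔ ∃ Rejected
  NotSubset⇔rejected coherent = mk⇔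
    (λ (H , (τ , τ∈L , H≃) , H∉) → τ , τ∈L , λ acc → H∉ (k , τ , τ∈L , acc , H≃))
    λ (τ , τ∈L , rejected) →
      G k τ , (τ , τ∈L , ≃-refl (G k τ)) ,
      λ (k′ , τ′ , τ′∈L , acc′ , iso) →
        rejected (Equivalence.from (proj₁ (coherent k k′ τ τ′ τ∈L τ′∈L iso)) acc′)

theorem5 : (Sym : Set) (ar : Sym → ℕ)
           (D : Terms.DecompositionClass Sym ar) (𝒜 : Terms.Automation Sym ar D)
           (C : Terms.DPCore Sym ar) →
           Terms.Setting.Coherent Sym ar D C →
           (k : ℕ) →
           Terms.Setting.NotSubset Sym ar D C k ⇔ Terms.Setting.Refute.Refutation Sym ar D C 𝒜 k
theorem5 Sym ar D 𝒜 C coherent k =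
  ⇔-trans (NotSubset⇔rejected coherent)
    (⇔-trans rejected⇔inconsistent-realized (⇔-sym Refutation⇔inconsistent-realized))
  where open Refutations Sym ar D 𝒜 C k
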